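{- Let $A$ be a commutative ring with $2\in A^\times$, $(R,*)$ an involutive $A$-algebra and $(D,P)$ a $2d$-dimensional weak symplectic determinant law on $(R,*)$ over $A$. Then for every commutative $A$-algebra $B$ and all commuting elements $x,y\in R^+\otimes_AB$, we have $xy\in R^+\otimes_AB$ and $P_B(xy)=P_B(x)P_B(y)$.
   Context: An involutive $A$-algebra is a unital associative $A$-algebra with $A$-linear anti-involution $*$ (extended $B$-linearly to $R\otimes_AB$); $R^+=\{x:x^*=x\}$. A polynomial law is a family $P_B$ natural in commutative $A$-algebras $B$, homogeneous of degree $n$ if $P_B(bx)=b^nP_B(x)$. A $2d$-dimensional weak symplectic determinant law is a pair $(D,P)$: $D\colon R\to A$ homogeneous of degree $2d$, multiplicative ($D_B(1)=1$, $D_B(xy)=D_B(x)D_B(y)$), $D_B(x^*)=D_B(x)$; $P\colon R^+\to A$ homogeneous of degree $d$ with $P_B(x)^2=D_B(x)$ for $x\in R^+\otimes_AB$ and $P_A(1)=1$. -}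

module Defs where

open import Level using (Level; _⊔_) renaming (suc to lsuc)
open import Algebra.Bundles using (CommutativeRing; Ring)
import Algebra.Bundles
open import Algebra.Morphism.Bundles using (RingHomomorphism)
import Algebra.Morphism.Construct.Identity as Id
import Algebra.Definitions.RawSemiring as RawSemiringDefs
open import Data.List using (List; []; _∷_; _++_; map; concatMap; [_])
open import Data.Nat using (ℕ) renaming (_*_ to _*ℕ_)
open import Data.Product using (_×_; _,_; Σ)

TwoInvertible : ∀ {c ℓ} → CommutativeRing c ℓ → Set (c ⊔ ℓ)
TwoInvertible A = Σ Carrier λ u → u * (1# + 1#) ≈ 1#
  where open CommutativeRing A

record CommAlg {c ℓ} (A : CommutativeRing c ℓ) (b ℓb : Level)
       : Set (c ⊔ ℓ ⊔ lsuc (b ⊔ ℓb)) where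
  field
    ring      : CommutativeRing b ℓb
    structure : RingHomomorphism (CommutativeRing.rawRing A)
                                 (CommutativeRing.rawRing ring)
  open CommutativeRing ring public hiding (ring)

  ι : CommutativeRing.Carrier A → Carrier
  ι = RingHomomorphism.⟦_⟧ structure

_^[_]_ : ∀ {c ℓ b ℓb} {A : CommutativeRing c ℓ} (B : CommAlg A b ℓb) →
         CommAlg.Carrier B → ℕ → CommAlg.Carrier B
_^[_]_ B x n = RawSemiringDefs._^_ (Algebra.Bundles.Semiring.rawSemiring (CommAlg.semiring B)) x n

selfAlg : ∀ {c ℓ} (A : CommutativeRing c ℓ) → CommAlg A c ℓ
selfAlg A = record
  { ring      = A
  ; structure = Id.ringHomomorphism (CommutativeRing.ring A)
  }

record AlgHom {c ℓ b ℓb b' ℓb'} {A : CommutativeRing c ℓ}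
       (B : CommAlg A b ℓb) (C : CommAlg A b' ℓb')
       : Set (c ⊔ b ⊔ ℓb ⊔ b' ⊔ ℓb') where
  private
    module B = CommAlg B
    module C = CommAlg C
  field
    hom    : RingHomomorphism B.rawRing C.rawRing
    over-A : ∀ a → RingHomomorphism.⟦_⟧ hom (B.ι a) C.≈ C.ι a

  ⟦_⟧ : B.Carrier → C.Carrier
  ⟦_⟧ = RingHomomorphism.⟦_⟧ hom

record InvolutiveAlgebra {c ℓ} (A : CommutativeRing c ℓ) (r ℓr : Level)
       : Set (c ⊔ ℓ ⊔ lsuc (r ⊔ ℓr)) where
  field
    ring      : Ring r ℓr
    structure : RingHomomorphism (CommutativeRing.rawRing A) (Ring.rawRing ring)
  open Ring ring public

  ι : CommutativeRing.Carrier A → Carrier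
  ι = RingHomomorphism.⟦_⟧ structure

  field
    central   : ∀ a x → ι a * x ≈ x * ι a
    star      : Carrier → Carrier
    star-cong : ∀ {x y} → x ≈ y → star x ≈ star y
    star-+    : ∀ x y → star (x + y) ≈ star x + star y
    star-*    : ∀ x y → star (x * y) ≈ star y * star x
    star-ι    : ∀ a x → star (ι a * x) ≈ ι a * star x
    star-star : ∀ x → star (star x) ≈ x

-- The tensor product R ⊗_A B (B a commutative A-algebra), as a setoid:
-- finite formal sums of pure tensors r ⊗ b, modulo the equivalence
-- relation generated (compatibly with addition = concatenation) by
-- commutativity of addition, bilinearity, 0 ⊗ b = 0, and
-- (a·r) ⊗ b = r ⊗ (a·b).

module Tensor {c ℓ r ℓr b ℓb} {A : CommutativeRing c ℓ}
              (R : InvolutiveAlgebra A r ℓr) (B : CommAlg A b ℓb) where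
  private
    module R = InvolutiveAlgebra R
    module B = CommAlg B

  T : Set (r ⊔ b)
  T = List (R.Carrier × B.Carrier)

  infix 4 _∼_
  data _∼_ : T → T → Set (c ⊔ r ⊔ ℓr ⊔ b ⊔ ℓb) where
    ∼-refl  : ∀ {x} → x ∼ x
    ∼-sym   : ∀ {x y} → x ∼ y → y ∼ x
    ∼-trans : ∀ {x y z} → x ∼ y → y ∼ z → x ∼ z
    ++-cong : ∀ {x x' y y'} → x ∼ x' → y ∼ y' → x ++ y ∼ x' ++ y'
    ++-comm : ∀ x y → x ++ y ∼ y ++ x
    pure-cong : ∀ {s s' t t'} → s R.≈ s' → t B.≈ t' →
                [ (s , t) ] ∼ [ (s' , t') ]
    add-left  : ∀ s s' t → [ (s R.+ s' , t) ] ∼ (s , t) ∷ (s' , t) ∷ []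
    add-right : ∀ s t t' → [ (s , t B.+ t') ] ∼ (s , t) ∷ (s , t') ∷ []
    zero-left : ∀ t → [ (R.0# , t) ] ∼ []
    balanced  : ∀ a s t → [ (R.ι a R.* s , t) ] ∼ [ (s , B.ι a B.* t) ]

  infixl 7 _·_
  _·_ : T → T → T
  x · y = concatMap (λ { (s , t) → map (λ { (s' , t') → (s R.* s' , t B.* t') }) y }) x

  one : T
  one = [ (R.1# , B.1#) ]

  infixr 7 _•_
  _•_ : B.Carrier → T → T
  β • x = map (λ { (s , t) → (s , β B.* t) }) x

  star : T → T
  star x = map (λ { (s , t) → (R.star s , t) }) x

  -- membership in R⁺ ⊗_A B (fixed points of the involution)
  IsSym : T → Set (c ⊔ r ⊔ ℓr ⊔ b ⊔ ℓb)
  IsSym x = star x ∼ x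

baseChange : ∀ {c ℓ r ℓr b ℓb b' ℓb'} {A : CommutativeRing c ℓ}
             (R : InvolutiveAlgebra A r ℓr) {B : CommAlg A b ℓb} {C : CommAlg A b' ℓb'}
             → AlgHom B C → Tensor.T R B → Tensor.T R C
baseChange R f x = map (λ { (s , t) → (s , AlgHom.⟦_⟧ f t) }) x

-- 2d-dimensional weak symplectic determinant laws on (R, *) over A.
-- A polynomial law is given by its components over all commutative
-- A-algebras B (in the universe of A), natural in B.

record WeakSymplecticDetLaw {c ℓ r ℓr} {A : CommutativeRing c ℓ}
       (R : InvolutiveAlgebra A r ℓr) (d : ℕ)
       : Set (lsuc (c ⊔ ℓ) ⊔ r ⊔ ℓr) where
  private
    module TB (B : CommAlg A c ℓ) = Tensor R B
    open TB using (T; _∼_; _·_; one; _•_; star; IsSym)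
    module Alg (B : CommAlg A c ℓ) = CommAlg B
  field
    D       : (B : CommAlg A c ℓ) → T B → Alg.Carrier B
    D-cong  : ∀ B {x y} → _∼_ B x y → Alg._≈_ B (D B x) (D B y)
    D-nat   : ∀ B C (f : AlgHom B C) x →
              Alg._≈_ C (D C (baseChange R f x)) (AlgHom.⟦_⟧ f (D B x))
    D-homog : ∀ B β x → Alg._≈_ B (D B (_•_ B β x)) (Alg._*_ B (B ^[ β ] (2 *ℕ d)) (D B x))
    D-one   : ∀ B → Alg._≈_ B (D B (one B)) (Alg.1# B)
    D-mul   : ∀ B x y → Alg._≈_ B (D B (_·_ B x y)) (Alg._*_ B (D B x) (D B y))
    D-star  : ∀ B x → Alg._≈_ B (D B (star B x)) (D B x)

    P       : (B : CommAlg A c ℓ) → (x : T B) → IsSym B x → Alg.Carrier B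
    P-cong  : ∀ B {x y} (px : IsSym B x) (py : IsSym B y) → _∼_ B x y →
              Alg._≈_ B (P B x px) (P B y py)
    P-nat   : ∀ B C (f : AlgHom B C) x (px : IsSym B x)
              (pfx : IsSym C (baseChange R f x)) →
              Alg._≈_ C (P C (baseChange R f x) pfx) (AlgHom.⟦_⟧ f (P B x px))
    P-homog : ∀ B β x (px : IsSym B x) (pβx : IsSym B (_•_ B β x)) →
              Alg._≈_ B (P B (_•_ B β x) pβx) (Alg._*_ B (B ^[ β ] d) (P B x px))
    P-square : ∀ B x (px : IsSym B x) →
               Alg._≈_ B (Alg._*_ B (P B x px) (P B x px)) (D B x)
    P-one   : ∀ (p1 : IsSym (selfAlg A) (one (selfAlg A))) →
              CommutativeRing._≈_ A (P (selfAlg A) (one (selfAlg A)) p1)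
                                    (CommutativeRing.1# A)

{-# OPTIONS --safe #-}
module Submission where

-- Over the polynomial algebra B[X] the element segment z = (1 - X) ⊗ 1 + X z is symmetric and
-- specialises to 1 at X = 0 and to z at X = 1; segment x and segment y commute. Then
-- f = P(segment x · segment y) and g = P(segment x) P(segment y) satisfy f² = D(segment x · segment y)
-- = g², and both have constant term P(1) = 1. So (f - g)(f + g) = 0 where f + g has constant term 2,
-- a unit, hence is a non-zero-divisor: f = g. Setting X = 1 gives P(xy) = P(x) P(y).

open import Algebra.Bundles using (CommutativeRing; CommutativeMonoid; RawRing)
open import Algebra.Morphism.Bundles using (RingHomomorphism)
import Algebra.Morphism.Construct.Composition as Compose
import Algebra.Properties.AbelianGroup as AbelianGroupProperties
import Algebra.Properties.CommutativeSemigroup as CommutativeSemigroupProperties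
import Algebra.Properties.Ring as RingProperties
open import Data.List using (List; []; _∷_; _++_; [_]; map; foldr)
import Data.List.Properties as List
open import Data.Nat using (ℕ; zero; suc)
open import Data.Product using (Σ; _×_; _,_; proj₁; proj₂)
open import Function using (_∘_)
import Relation.Binary.PropositionalEquality as ≡
open ≡ using (_≡_)
import Relation.Binary.Reasoning.Setoid as SetoidReasoning

open import Defs

module _ {a ℓa b ℓb} {X : RawRing a ℓa} {Y : RawRing b ℓb} where
  private
    module X = RawRing X
    module Y = RawRing Y

  mkRingHomomorphism : (f : X.Carrier → Y.Carrier) →
    (∀ {x y} → x X.≈ y → f x Y.≈ f y) →
    (∀ x y → f (x X.+ y) Y.≈ f x Y.+ f y) → f X.0# Y.≈ Y.0# →
    (∀ x y → f (x X.* y) Y.≈ f x Y.* f y) → f X.1# Y.≈ Y.1# →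
    (∀ x → f (X.- x) Y.≈ Y.- f x) →
    RingHomomorphism X Y
  mkRingHomomorphism f cong +-homo 0#-homo *-homo 1#-homo -‿homo = record
    { ⟦_⟧ = f
    ; isRingHomomorphism = record
      { isSemiringHomomorphism = record
        { isNearSemiringHomomorphism = record
          { +-isMonoidHomomorphism = record
            { isMagmaHomomorphism = record
              { isRelHomomorphism = record { cong = cong }
              ; homo = +-homo }
            ; ε-homo = 0#-homo }
          ; *-homo = *-homo }
        ; 1#-homo = 1#-homo }
      ; -‿homo = -‿homo } }

module _ {b ℓb} (K : CommutativeRing b ℓb) where
  open CommutativeRing K
  open SetoidReasoning setoid
  open AbelianGroupProperties +-abelianGroup using (x∙y⁻¹≈ε⇒x≈y)
  open RingProperties ring using ([y-z]x≈yx-zx)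

  ≈-from-squares : ∀ f g → (∀ e → e * (f + g) ≈ 0# → e ≈ 0#) → f * f ≈ g * g → f ≈ g
  ≈-from-squares f g cancel ff≈gg = x∙y⁻¹≈ε⇒x≈y f g (cancel (f - g) (begin
    (f - g) * (f + g)              ≈⟨ [y-z]x≈yx-zx (f + g) f g ⟩
    f * (f + g) - g * (f + g)      ≈⟨ +-congʳ f[f+g]≈g[f+g] ⟩
    g * (f + g) - g * (f + g)      ≈⟨ -‿inverseʳ _ ⟩
    0#                             ∎))
    where
    f[f+g]≈g[f+g] : f * (f + g) ≈ g * (f + g)
    f[f+g]≈g[f+g] = begin
      f * (f + g)       ≈⟨ distribˡ f f g ⟩
      f * f + f * g     ≈⟨ +-cong ff≈gg (*-comm f g) ⟩
      g * g + g * f     ≈⟨ distribˡ g g f ⟨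
      g * (g + f)       ≈⟨ *-congˡ (+-comm g f) ⟩
      g * (f + g)       ∎

module Polynomial {b ℓb} (K : CommutativeRing b ℓb) where
  open CommutativeRing K hiding (zero)
  open SetoidReasoning setoid
  open AbelianGroupProperties +-abelianGroup using (ε⁻¹≈ε; ⁻¹-∙-comm)
  open CommutativeSemigroupProperties +-commutativeSemigroup using (interchange; x∙yz≈y∙xz)
  open CommutativeSemigroupProperties *-commutativeSemigroup using ()
    renaming (x∙yz≈y∙xz to x*yz≈y*xz)

  -- a₀ ∷ a₁ ∷ ⋯ represents a₀ + a₁ X + ⋯ ; trailing zeros are allowed.
  Poly : Set b
  Poly = List Carrier

  coeff : Poly → ℕ → Carrier
  coeff []      n       = 0#
  coeff (a ∷ p) zero    = a
  coeff (a ∷ p) (suc n) = coeff p n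

  infix 4 _≋_
  record _≋_ (p q : Poly) : Set ℓb where
    constructor mk≋
    field at : ∀ n → coeff p n ≈ coeff q n
  open _≋_ public

  ≋-refl : ∀ {p} → p ≋ p
  ≋-refl = mk≋ λ _ → refl

  ≋-sym : ∀ {p q} → p ≋ q → q ≋ p
  ≋-sym e = mk≋ λ n → sym (at e n)

  ≋-trans : ∀ {p q r} → p ≋ q → q ≋ r → p ≋ r
  ≋-trans e f = mk≋ λ n → trans (at e n) (at f n)

  ∷-cong : ∀ {a a' p p'} → a ≈ a' → p ≋ p' → a ∷ p ≋ a' ∷ p'
  ∷-cong e f = mk≋ λ { zero → e ; (suc n) → at f n }

  ∷≋[] : ∀ {a p} → a ≈ 0# → p ≋ [] → a ∷ p ≋ []
  ∷≋[] e f = mk≋ λ { zero → e ; (suc n) → at f n }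

  ∷-cong⁻ : ∀ {a a' p p'} → a ∷ p ≋ a' ∷ p' → a ≈ a' × p ≋ p'
  ∷-cong⁻ e = at e zero , mk≋ λ n → at e (suc n)

  ∷≋[]⁻ : ∀ {a p} → a ∷ p ≋ [] → a ≈ 0# × p ≋ []
  ∷≋[]⁻ e = at e zero , mk≋ λ n → at e (suc n)

  infixl 6 _⊞_
  infixl 7 _⊠_ _⋆_

  _⊞_ : Poly → Poly → Poly
  []      ⊞ q       = q
  (a ∷ p) ⊞ []      = a ∷ p
  (a ∷ p) ⊞ (c ∷ q) = (a + c) ∷ (p ⊞ q)

  ⊟_ : Poly → Poly
  ⊟ p = map -_ p

  _⋆_ : Carrier → Poly → Poly
  a ⋆ p = map (a *_) p

  _⊠_ : Poly → Poly → Poly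
  []      ⊠ q = []
  (a ∷ p) ⊠ q = a ⋆ q ⊞ (0# ∷ p ⊠ q)

  coeff-⊞ : ∀ p q n → coeff (p ⊞ q) n ≈ coeff p n + coeff q n
  coeff-⊞ []      q       n       = sym (+-identityˡ _)
  coeff-⊞ (a ∷ p) []      n       = sym (+-identityʳ _)
  coeff-⊞ (a ∷ p) (c ∷ q) zero    = refl
  coeff-⊞ (a ∷ p) (c ∷ q) (suc n) = coeff-⊞ p q n

  coeff-⊟ : ∀ p n → coeff (⊟ p) n ≈ - coeff p n
  coeff-⊟ []      n       = sym ε⁻¹≈ε
  coeff-⊟ (a ∷ p) zero    = refl
  coeff-⊟ (a ∷ p) (suc n) = coeff-⊟ p n

  coeff-⋆ : ∀ a p n → coeff (a ⋆ p) n ≈ a * coeff p n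
  coeff-⋆ a []      n       = sym (zeroʳ a)
  coeff-⋆ a (c ∷ p) zero    = refl
  coeff-⋆ a (c ∷ p) (suc n) = coeff-⋆ a p n

  ⊞-cong : ∀ {p p' q q'} → p ≋ p' → q ≋ q' → p ⊞ q ≋ p' ⊞ q'
  ⊞-cong {p} {p'} {q} {q'} e f = mk≋ λ n → begin
    coeff (p ⊞ q) n            ≈⟨ coeff-⊞ p q n ⟩
    coeff p n + coeff q n      ≈⟨ +-cong (at e n) (at f n) ⟩
    coeff p' n + coeff q' n    ≈⟨ coeff-⊞ p' q' n ⟨
    coeff (p' ⊞ q') n          ∎

  ⊟-cong : ∀ {p p'} → p ≋ p' → ⊟ p ≋ ⊟ p'
  ⊟-cong {p} {p'} e = mk≋ λ n →
    trans (coeff-⊟ p n) (trans (-‿cong (at e n)) (sym (coeff-⊟ p' n)))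

  ⋆-cong : ∀ {a a' p p'} → a ≈ a' → p ≋ p' → a ⋆ p ≋ a' ⋆ p'
  ⋆-cong {a} {a'} {p} {p'} e f = mk≋ λ n →
    trans (coeff-⋆ a p n) (trans (*-cong e (at f n)) (sym (coeff-⋆ a' p' n)))

  ⊞-assoc : ∀ p q r → p ⊞ q ⊞ r ≋ p ⊞ (q ⊞ r)
  ⊞-assoc p q r = mk≋ λ n → begin
    coeff (p ⊞ q ⊞ r) n                     ≈⟨ trans (coeff-⊞ (p ⊞ q) r n) (+-congʳ (coeff-⊞ p q n)) ⟩
    coeff p n + coeff q n + coeff r n       ≈⟨ +-assoc _ _ _ ⟩
    coeff p n + (coeff q n + coeff r n)     ≈⟨ trans (coeff-⊞ p (q ⊞ r) n) (+-congˡ (coeff-⊞ q r n)) ⟨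
    coeff (p ⊞ (q ⊞ r)) n                   ∎

  ⊞-comm : ∀ p q → p ⊞ q ≋ q ⊞ p
  ⊞-comm p q = mk≋ λ n → trans (coeff-⊞ p q n) (trans (+-comm _ _) (sym (coeff-⊞ q p n)))

  ⊞-identityʳ : ∀ p → p ⊞ [] ≋ p
  ⊞-identityʳ p = mk≋ λ n → trans (coeff-⊞ p [] n) (+-identityʳ _)

  ⊟-inverseˡ : ∀ p → ⊟ p ⊞ p ≋ []
  ⊟-inverseˡ p = mk≋ λ n →
    trans (coeff-⊞ (⊟ p) p n) (trans (+-congʳ (coeff-⊟ p n)) (-‿inverseˡ _))

  ⊟-inverseʳ : ∀ p → p ⊞ ⊟ p ≋ []
  ⊟-inverseʳ p = mk≋ λ n →
    trans (coeff-⊞ p (⊟ p) n) (trans (+-congˡ (coeff-⊟ p n)) (-‿inverseʳ _))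

  ⊞-interchange : ∀ p q r s → (p ⊞ q) ⊞ (r ⊞ s) ≋ (p ⊞ r) ⊞ (q ⊞ s)
  ⊞-interchange p q r s = mk≋ λ n → begin
    coeff ((p ⊞ q) ⊞ (r ⊞ s)) n
      ≈⟨ trans (coeff-⊞ (p ⊞ q) (r ⊞ s) n) (+-cong (coeff-⊞ p q n) (coeff-⊞ r s n)) ⟩
    (coeff p n + coeff q n) + (coeff r n + coeff s n)
      ≈⟨ interchange _ _ _ _ ⟩
    (coeff p n + coeff r n) + (coeff q n + coeff s n)
      ≈⟨ trans (coeff-⊞ (p ⊞ r) (q ⊞ s) n) (+-cong (coeff-⊞ p r n) (coeff-⊞ q s n)) ⟨
    coeff ((p ⊞ r) ⊞ (q ⊞ s)) n ∎

  ⊞-lswap : ∀ p q r → p ⊞ (q ⊞ r) ≋ q ⊞ (p ⊞ r)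
  ⊞-lswap p q r = mk≋ λ n → begin
    coeff (p ⊞ (q ⊞ r)) n                   ≈⟨ trans (coeff-⊞ p (q ⊞ r) n) (+-congˡ (coeff-⊞ q r n)) ⟩
    coeff p n + (coeff q n + coeff r n)     ≈⟨ x∙yz≈y∙xz _ _ _ ⟩
    coeff q n + (coeff p n + coeff r n)     ≈⟨ trans (coeff-⊞ q (p ⊞ r) n) (+-congˡ (coeff-⊞ p r n)) ⟨
    coeff (q ⊞ (p ⊞ r)) n                   ∎

  ⋆-distribˡ : ∀ a p q → a ⋆ (p ⊞ q) ≋ a ⋆ p ⊞ a ⋆ q
  ⋆-distribˡ a p q = mk≋ λ n → begin
    coeff (a ⋆ (p ⊞ q)) n              ≈⟨ trans (coeff-⋆ a (p ⊞ q) n) (*-congˡ (coeff-⊞ p q n)) ⟩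
    a * (coeff p n + coeff q n)        ≈⟨ distribˡ _ _ _ ⟩
    a * coeff p n + a * coeff q n      ≈⟨ trans (coeff-⊞ (a ⋆ p) (a ⋆ q) n) (+-cong (coeff-⋆ a p n) (coeff-⋆ a q n)) ⟨
    coeff (a ⋆ p ⊞ a ⋆ q) n            ∎

  ⋆-distribʳ : ∀ a c p → (a + c) ⋆ p ≋ a ⋆ p ⊞ c ⋆ p
  ⋆-distribʳ a c p = mk≋ λ n → begin
    coeff ((a + c) ⋆ p) n              ≈⟨ coeff-⋆ (a + c) p n ⟩
    (a + c) * coeff p n                ≈⟨ distribʳ _ _ _ ⟩
    a * coeff p n + c * coeff p n      ≈⟨ trans (coeff-⊞ (a ⋆ p) (c ⋆ p) n) (+-cong (coeff-⋆ a p n) (coeff-⋆ c p n)) ⟨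
    coeff (a ⋆ p ⊞ c ⋆ p) n            ∎

  ⋆-assoc : ∀ a c p → (a * c) ⋆ p ≋ a ⋆ (c ⋆ p)
  ⋆-assoc a c p = mk≋ λ n → begin
    coeff ((a * c) ⋆ p) n     ≈⟨ coeff-⋆ (a * c) p n ⟩
    (a * c) * coeff p n       ≈⟨ *-assoc _ _ _ ⟩
    a * (c * coeff p n)       ≈⟨ trans (coeff-⋆ a (c ⋆ p) n) (*-congˡ (coeff-⋆ c p n)) ⟨
    coeff (a ⋆ (c ⋆ p)) n     ∎

  ⋆-identityˡ : ∀ p → 1# ⋆ p ≋ p
  ⋆-identityˡ p = mk≋ λ n → trans (coeff-⋆ 1# p n) (*-identityˡ _)

  ⋆-zeroˡ : ∀ {a} p → a ≈ 0# → a ⋆ p ≋ []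
  ⋆-zeroˡ {a} p e = mk≋ λ n → trans (coeff-⋆ a p n) (trans (*-congʳ e) (zeroˡ _))

  ⊞-zero : ∀ {p q} → p ≋ [] → q ≋ [] → p ⊞ q ≋ []
  ⊞-zero {p} {q} e f = mk≋ λ n →
    trans (coeff-⊞ p q n) (trans (+-cong (at e n) (at f n)) (+-identityˡ _))

  ⊠-zeroˡ : ∀ {p} q → p ≋ [] → p ⊠ q ≋ []
  ⊠-zeroˡ {[]}    q e = ≋-refl
  ⊠-zeroˡ {a ∷ p} q e =
    ⊞-zero (⋆-zeroˡ q (proj₁ (∷≋[]⁻ e))) (∷≋[] refl (⊠-zeroˡ q (proj₂ (∷≋[]⁻ e))))

  ⊠-zeroʳ : ∀ p → p ⊠ [] ≋ []
  ⊠-zeroʳ []      = ≋-refl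
  ⊠-zeroʳ (a ∷ p) = ∷≋[] refl (⊠-zeroʳ p)

  ⊠-congˡ : ∀ {p p'} q → p ≋ p' → p ⊠ q ≋ p' ⊠ q
  ⊠-congˡ {[]}    {[]}      q e = ≋-refl
  ⊠-congˡ {[]}    {a' ∷ p'} q e = ≋-sym (⊠-zeroˡ q (≋-sym e))
  ⊠-congˡ {a ∷ p} {[]}      q e = ⊠-zeroˡ q e
  ⊠-congˡ {a ∷ p} {a' ∷ p'} q e =
    ⊞-cong (⋆-cong (proj₁ (∷-cong⁻ e)) ≋-refl) (∷-cong refl (⊠-congˡ q (proj₂ (∷-cong⁻ e))))

  ⊠-congʳ : ∀ p {q q'} → q ≋ q' → p ⊠ q ≋ p ⊠ q'
  ⊠-congʳ []      e = ≋-refl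
  ⊠-congʳ (a ∷ p) e = ⊞-cong (⋆-cong refl e) (∷-cong refl (⊠-congʳ p e))

  ⊠-cong : ∀ {p p' q q'} → p ≋ p' → q ≋ q' → p ⊠ q ≋ p' ⊠ q'
  ⊠-cong {p' = p'} {q = q} e f = ≋-trans (⊠-congˡ q e) (⊠-congʳ p' f)

  ⊠-∷ʳ : ∀ p c q → p ⊠ (c ∷ q) ≋ c ⋆ p ⊞ (0# ∷ p ⊠ q)
  ⊠-∷ʳ []      c q = ≋-sym (∷≋[] refl ≋-refl)
  ⊠-∷ʳ (a ∷ p) c q =
    ∷-cong (trans (+-identityʳ _) (trans (*-comm a c) (sym (+-identityʳ _))))
      (≋-trans (⊞-cong (≋-refl {a ⋆ q}) (⊠-∷ʳ p c q)) (⊞-lswap (a ⋆ q) (c ⋆ p) (0# ∷ p ⊠ q)))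

  ⊠-comm : ∀ p q → p ⊠ q ≋ q ⊠ p
  ⊠-comm []      q = ≋-sym (⊠-zeroʳ q)
  ⊠-comm (a ∷ p) q =
    ≋-trans (⊞-cong (≋-refl {a ⋆ q}) (∷-cong refl (⊠-comm p q))) (≋-sym (⊠-∷ʳ q a p))

  ⋆-⊠ : ∀ a p q → a ⋆ p ⊠ q ≋ a ⋆ (p ⊠ q)
  ⋆-⊠ a []      q = ≋-refl
  ⋆-⊠ a (c ∷ p) q =
    ≋-trans (⊞-cong (⋆-assoc a c q) (∷-cong (sym (zeroʳ a)) (⋆-⊠ a p q)))
            (≋-sym (⋆-distribˡ a (c ⋆ q) (0# ∷ p ⊠ q)))

  ⊠-distribʳ : ∀ r p q → (p ⊞ q) ⊠ r ≋ p ⊠ r ⊞ q ⊠ r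
  ⊠-distribʳ r []      q       = ≋-refl
  ⊠-distribʳ r (a ∷ p) []      = ≋-sym (⊞-identityʳ _)
  ⊠-distribʳ r (a ∷ p) (c ∷ q) =
    ≋-trans (⊞-cong (⋆-distribʳ a c r) (∷-cong (sym (+-identityˡ 0#)) (⊠-distribʳ r p q)))
            (⊞-interchange (a ⋆ r) (c ⋆ r) (0# ∷ p ⊠ r) (0# ∷ q ⊠ r))

  ⊠-distribˡ : ∀ p q r → p ⊠ (q ⊞ r) ≋ p ⊠ q ⊞ p ⊠ r
  ⊠-distribˡ p q r =
    ≋-trans (⊠-comm p (q ⊞ r)) (≋-trans (⊠-distribʳ p q r) (⊞-cong (⊠-comm q p) (⊠-comm r p)))

  ⊠-assoc : ∀ p q r → p ⊠ q ⊠ r ≋ p ⊠ (q ⊠ r)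
  ⊠-assoc []      q r = ≋-refl
  ⊠-assoc (a ∷ p) q r =
    ≋-trans (⊠-distribʳ r (a ⋆ q) (0# ∷ p ⊠ q))
      (⊞-cong (⋆-⊠ a q r) (≋-trans (⊞-cong (⋆-zeroˡ r refl) (≋-refl {0# ∷ p ⊠ q ⊠ r}))
                                    (∷-cong refl (⊠-assoc p q r))))

  ⊠-identityˡ : ∀ p → (1# ∷ []) ⊠ p ≋ p
  ⊠-identityˡ p = ≋-trans (⊞-cong (⋆-identityˡ p) (∷≋[] refl ≋-refl)) (⊞-identityʳ p)

  ⊠-identityʳ : ∀ p → p ⊠ (1# ∷ []) ≋ p
  ⊠-identityʳ p = ≋-trans (⊠-comm p _) (⊠-identityˡ p)

  polynomialRing : CommutativeRing b ℓb
  polynomialRing = record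
    { Carrier = Poly ; _≈_ = _≋_ ; _+_ = _⊞_ ; _*_ = _⊠_ ; -_ = ⊟_ ; 0# = [] ; 1# = 1# ∷ []
    ; isCommutativeRing = record
      { isRing = record
        { +-isAbelianGroup = record
          { isGroup = record
            { isMonoid = record
              { isSemigroup = record
                { isMagma = record
                  { isEquivalence = record { refl = ≋-refl ; sym = ≋-sym ; trans = ≋-trans }
                  ; ∙-cong = ⊞-cong }
                ; assoc = ⊞-assoc }
              ; identity = (λ _ → ≋-refl) , ⊞-identityʳ }
            ; inverse = ⊟-inverseˡ , ⊟-inverseʳ
            ; ⁻¹-cong = ⊟-cong }
          ; comm = ⊞-comm }
        ; *-cong = ⊠-cong
        ; *-assoc = ⊠-assoc
        ; *-identity = ⊠-identityˡ , ⊠-identityʳ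
        ; distrib = ⊠-distribˡ , ⊠-distribʳ }
      ; *-comm = ⊠-comm } }

  eval₀ : Poly → Carrier
  eval₀ p = coeff p 0

  eval₀-⊠ : ∀ p q → eval₀ (p ⊠ q) ≈ eval₀ p * eval₀ q
  eval₀-⊠ []      q = sym (zeroˡ _)
  eval₀-⊠ (a ∷ p) q = trans (coeff-⊞ (a ⋆ q) (0# ∷ p ⊠ q) 0) (trans (+-identityʳ _) (coeff-⋆ a q 0))

  eval₁ : Poly → Carrier
  eval₁ = foldr _+_ 0#

  eval₁-zero : ∀ {p} → p ≋ [] → eval₁ p ≈ 0#
  eval₁-zero {[]}    e = refl
  eval₁-zero {a ∷ p} e =
    trans (+-cong (proj₁ (∷≋[]⁻ e)) (eval₁-zero (proj₂ (∷≋[]⁻ e)))) (+-identityˡ 0#)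

  eval₁-cong : ∀ {p q} → p ≋ q → eval₁ p ≈ eval₁ q
  eval₁-cong {[]}    {[]}    e = refl
  eval₁-cong {[]}    {c ∷ q} e = sym (eval₁-zero (≋-sym e))
  eval₁-cong {a ∷ p} {[]}    e = eval₁-zero e
  eval₁-cong {a ∷ p} {c ∷ q} e = +-cong (proj₁ (∷-cong⁻ e)) (eval₁-cong (proj₂ (∷-cong⁻ e)))

  eval₁-⊞ : ∀ p q → eval₁ (p ⊞ q) ≈ eval₁ p + eval₁ q
  eval₁-⊞ []      q       = sym (+-identityˡ _)
  eval₁-⊞ (a ∷ p) []      = sym (+-identityʳ _)
  eval₁-⊞ (a ∷ p) (c ∷ q) = trans (+-congˡ (eval₁-⊞ p q)) (interchange a c (eval₁ p) (eval₁ q))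

  eval₁-⋆ : ∀ a p → eval₁ (a ⋆ p) ≈ a * eval₁ p
  eval₁-⋆ a []      = sym (zeroʳ a)
  eval₁-⋆ a (c ∷ p) = trans (+-congˡ (eval₁-⋆ a p)) (sym (distribˡ _ _ _))

  eval₁-⊠ : ∀ p q → eval₁ (p ⊠ q) ≈ eval₁ p * eval₁ q
  eval₁-⊠ []      q = sym (zeroˡ _)
  eval₁-⊠ (a ∷ p) q = begin
    eval₁ (a ⋆ q ⊞ (0# ∷ p ⊠ q))          ≈⟨ eval₁-⊞ (a ⋆ q) (0# ∷ p ⊠ q) ⟩
    eval₁ (a ⋆ q) + (0# + eval₁ (p ⊠ q))  ≈⟨ +-cong (eval₁-⋆ a q) (trans (+-identityˡ _) (eval₁-⊠ p q)) ⟩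
    a * eval₁ q + eval₁ p * eval₁ q       ≈⟨ distribʳ _ _ _ ⟨
    (a + eval₁ p) * eval₁ q               ∎

  eval₁-⊟ : ∀ p → eval₁ (⊟ p) ≈ - eval₁ p
  eval₁-⊟ []      = sym ε⁻¹≈ε
  eval₁-⊟ (a ∷ p) = trans (+-congˡ (eval₁-⊟ p)) (⁻¹-∙-comm _ _)

  -- Peel off the lowest coefficient: a ⋅ eval₀ u = 0 forces a = 0, then recurse on the tail.
  unitConstantTerm⇒cancellable : ∀ {u v} → v * eval₀ u ≈ 1# → ∀ e → e ⊠ u ≋ [] → e ≋ []
  unitConstantTerm⇒cancellable         inv []      eu≋0 = ≋-refl
  unitConstantTerm⇒cancellable {u} {v} inv (a ∷ e) eu≋0 =
    ∷≋[] a≈0 (unitConstantTerm⇒cancellable inv e (mk≋ λ n → begin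
      coeff (e ⊠ u) n                                  ≈⟨ +-identityˡ _ ⟨
      0# + coeff (e ⊠ u) n                             ≈⟨ +-congʳ (at (⋆-zeroˡ u a≈0) (suc n)) ⟨
      coeff (a ⋆ u) (suc n) + coeff (e ⊠ u) n          ≈⟨ coeff-⊞ (a ⋆ u) (0# ∷ e ⊠ u) (suc n) ⟨
      coeff ((a ∷ e) ⊠ u) (suc n)                      ≈⟨ at eu≋0 (suc n) ⟩
      0#                                               ∎))
    where
    a≈0 : a ≈ 0#
    a≈0 = begin
      a                          ≈⟨ trans (*-congˡ inv) (*-identityʳ a) ⟨
      a * (v * eval₀ u)          ≈⟨ x*yz≈y*xz a v (eval₀ u) ⟩
      v * (a * eval₀ u)          ≈⟨ *-congˡ (sym (eval₀-⊠ (a ∷ e) u)) ⟩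
      v * eval₀ ((a ∷ e) ⊠ u)    ≈⟨ *-congˡ (at eu≋0 0) ⟩
      v * 0#                     ≈⟨ zeroʳ v ⟩
      0#                         ∎

module PolynomialAlgebra {c ℓ b ℓb} {A : CommutativeRing c ℓ} (B : CommAlg A b ℓb) where
  private
    module B = CommAlg B
  open Polynomial (CommAlg.ring B) public

  const : B.Carrier → Poly
  const t = t ∷ []

  private
    constHom : RingHomomorphism B.rawRing (CommutativeRing.rawRing polynomialRing)
    constHom = mkRingHomomorphism const (λ e → ∷-cong e ≋-refl) (λ _ _ → ≋-refl)
      (∷≋[] B.refl ≋-refl) (λ _ _ → ∷-cong (B.sym (B.+-identityʳ _)) ≋-refl) ≋-refl (λ _ → ≋-refl)

  B[X] : CommAlg A b ℓb
  B[X] = record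
    { ring      = polynomialRing
    ; structure = record
      { ⟦_⟧                = const ∘ B.ι
      ; isRingHomomorphism = Compose.isRingHomomorphism ≋-trans
          (RingHomomorphism.isRingHomomorphism (CommAlg.structure B))
          (RingHomomorphism.isRingHomomorphism constHom) } }

  constAlgHom : AlgHom B B[X]
  constAlgHom = record { hom = constHom ; over-A = λ _ → ≋-refl }

  eval₀AlgHom : AlgHom B[X] B
  eval₀AlgHom = record
    { hom    = mkRingHomomorphism eval₀ (λ e → at e 0) (λ p q → coeff-⊞ p q 0) B.refl eval₀-⊠
                                  B.refl (λ p → coeff-⊟ p 0)
    ; over-A = λ _ → B.refl }

  eval₁AlgHom : AlgHom B[X] B
  eval₁AlgHom = record
    { hom    = mkRingHomomorphism eval₁ eval₁-cong eval₁-⊞ B.refl eval₁-⊠ (B.+-identityʳ _) eval₁-⊟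
    ; over-A = λ _ → B.+-identityʳ _ }

module _ {c ℓ b ℓb} {A : CommutativeRing c ℓ} (two : TwoInvertible A) (B : CommAlg A b ℓb) where
  private
    module A = CommutativeRing A
    module B = CommAlg B
    module ι = RingHomomorphism (CommAlg.structure B)
    open SetoidReasoning B.setoid
  open PolynomialAlgebra B

  ≋-from-squares-eval₀≈1 : ∀ {f g} → eval₀ f B.≈ B.1# → eval₀ g B.≈ B.1# → f ⊠ f ≋ g ⊠ g → f ≋ g
  ≋-from-squares-eval₀≈1 {f} {g} f₀≈1 g₀≈1 =
    ≈-from-squares polynomialRing f g (unitConstantTerm⇒cancellable ½·[f+g]₀≈1)
    where
    ½ : A.Carrier
    ½ = proj₁ two
    ½·[f+g]₀≈1 : B.ι ½ B.* eval₀ (f ⊞ g) B.≈ B.1#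
    ½·[f+g]₀≈1 = begin
      B.ι ½ B.* eval₀ (f ⊞ g)              ≈⟨ B.*-congˡ (B.trans (coeff-⊞ f g 0) (B.+-cong f₀≈1 g₀≈1)) ⟩
      B.ι ½ B.* (B.1# B.+ B.1#)            ≈⟨ B.*-congˡ (B.+-cong ι.1#-homo ι.1#-homo) ⟨
      B.ι ½ B.* (B.ι A.1# B.+ B.ι A.1#)    ≈⟨ B.trans (ι.*-homo _ _) (B.*-congˡ (ι.+-homo _ _)) ⟨
      B.ι (½ A.* (A.1# A.+ A.1#))          ≈⟨ B.trans (ι.⟦⟧-cong (proj₂ two)) ι.1#-homo ⟩
      B.1#                                  ∎

star-1# : ∀ {c ℓ r ℓr} {A : CommutativeRing c ℓ} (R : InvolutiveAlgebra A r ℓr) →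
          InvolutiveAlgebra._≈_ R (InvolutiveAlgebra.star R (InvolutiveAlgebra.1# R)) (InvolutiveAlgebra.1# R)
star-1# R = begin
  star 1#                        ≈⟨ *-identityʳ _ ⟨
  star 1# * 1#                   ≈⟨ *-congˡ (star-star 1#) ⟨
  star 1# * star (star 1#)       ≈⟨ star-* _ _ ⟨
  star (star 1# * 1#)            ≈⟨ star-cong (*-identityʳ _) ⟩
  star (star 1#)                 ≈⟨ star-star _ ⟩
  1#                             ∎
  where
  open InvolutiveAlgebra R
  open SetoidReasoning setoid

module TensorBasics {c ℓ r ℓr} {A : CommutativeRing c ℓ} (R : InvolutiveAlgebra A r ℓr)
                    {b ℓb} (B : CommAlg A b ℓb) where
  private
    module A = CommutativeRing A
    module R = InvolutiveAlgebra R
    module B = CommAlg B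
  open Tensor R B

  ≡⇒∼ : ∀ {x y} → x ≡ y → x ∼ y
  ≡⇒∼ ≡.refl = ∼-refl

  ++-commutativeMonoid : CommutativeMonoid _ _
  ++-commutativeMonoid = record
    { Carrier = T ; _≈_ = _∼_ ; _∙_ = _++_ ; ε = []
    ; isCommutativeMonoid = record
      { isMonoid = record
        { isSemigroup = record
          { isMagma = record
            { isEquivalence = record { refl = ∼-refl ; sym = ∼-sym ; trans = ∼-trans }
            ; ∙-cong = ++-cong }
          ; assoc = λ x y z → ≡⇒∼ (List.++-assoc x y z) }
        ; identity = (λ _ → ∼-refl) , (λ x → ≡⇒∼ (List.++-identityʳ x)) }
      ; comm = ++-comm } }

  module ∼-Reasoning = SetoidReasoning (CommutativeMonoid.setoid ++-commutativeMonoid)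
  open CommutativeSemigroupProperties (CommutativeMonoid.commutativeSemigroup ++-commutativeMonoid)
    public using () renaming (interchange to ++-interchange)

  Pure : Set _
  Pure = R.Carrier × B.Carrier

  map-cong : (F G : Pure → Pure) → (∀ q → [ F q ] ∼ [ G q ]) → ∀ w → map F w ∼ map G w
  map-cong F G F∼G []      = ∼-refl
  map-cong F G F∼G (q ∷ w) = ++-cong (F∼G q) (map-cong F G F∼G w)

  map-split : (F G H : Pure → Pure) → (∀ q → [ F q ] ∼ G q ∷ H q ∷ []) →
              ∀ w → map F w ∼ map G w ++ map H w
  map-split F G H F∼G+H []      = ∼-refl
  map-split F G H F∼G+H (q ∷ w) =
    ∼-trans (++-cong (F∼G+H q) (map-split F G H F∼G+H w))
            (++-interchange [ G q ] [ H q ] (map G w) (map H w))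

  map-zero : (F : Pure → Pure) → (∀ q → [ F q ] ∼ []) → ∀ w → map F w ∼ []
  map-zero F F∼0 []      = ∼-refl
  map-zero F F∼0 (q ∷ w) = ++-cong (F∼0 q) (map-zero F F∼0 w)

  pure-zeroʳ : ∀ s {t} → t B.≈ B.0# → [ (s , t) ] ∼ []
  pure-zeroʳ s {t} t≈0 = begin
    [ (s , t) ]                     ≈⟨ pure-cong R.refl (B.trans t≈0 (B.sym ι0*1≈0)) ⟩
    [ (s , B.ι A.0# B.* B.1#) ]     ≈⟨ balanced A.0# s B.1# ⟨
    [ (R.ι A.0# R.* s , B.1#) ]     ≈⟨ pure-cong (R.trans (R.*-congʳ ιR.0#-homo) (R.zeroˡ _)) B.refl ⟩
    [ (R.0# , B.1#) ]               ≈⟨ zero-left B.1# ⟩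
    []                              ∎
    where
    open ∼-Reasoning
    module ιR = RingHomomorphism (InvolutiveAlgebra.structure R)
    module ιB = RingHomomorphism (CommAlg.structure B)
    ι0*1≈0 : B.ι A.0# B.* B.1# B.≈ B.0#
    ι0*1≈0 = B.trans (B.*-congʳ ιB.0#-homo) (B.zeroˡ _)

module TensorMap {c ℓ r ℓr} {A : CommutativeRing c ℓ} (R : InvolutiveAlgebra A r ℓr)
                 {b ℓb b' ℓb'} (B : CommAlg A b ℓb) (C : CommAlg A b' ℓb') where
  private
    module R = InvolutiveAlgebra R
    module B = CommAlg B
    module C = CommAlg C
    module TB = Tensor R B
    module TC = Tensor R C
    open TensorBasics R C using (≡⇒∼)

  module Induced (g : R.Carrier → R.Carrier) (h : B.Carrier → C.Carrier)
                 (g-cong : ∀ {s s'} → s R.≈ s' → g s R.≈ g s')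
                 (g-+ : ∀ s s' → g (s R.+ s') R.≈ g s R.+ g s')
                 (g-0 : g R.0# R.≈ R.0#)
                 (g-ι : ∀ a s → g (R.ι a R.* s) R.≈ R.ι a R.* g s)
                 (h-cong : ∀ {t t'} → t B.≈ t' → h t C.≈ h t')
                 (h-+ : ∀ t t' → h (t B.+ t') C.≈ h t C.+ h t')
                 (h-ι : ∀ a t → h (B.ι a B.* t) C.≈ C.ι a C.* h t)
                 where

    g×h : R.Carrier × B.Carrier → R.Carrier × C.Carrier
    g×h (s , t) = (g s , h t)

    g⊗h : TB.T → TC.T
    g⊗h = map g×h

    g⊗h-map-++ : ∀ x y → g⊗h (x ++ y) TC.∼ g⊗h x ++ g⊗h y
    g⊗h-map-++ x y = ≡⇒∼ (List.map-++ g×h x y)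

    g⊗h-cong : ∀ {x y} → x TB.∼ y → g⊗h x TC.∼ g⊗h y
    g⊗h-cong TB.∼-refl          = TC.∼-refl
    g⊗h-cong (TB.∼-sym e)       = TC.∼-sym (g⊗h-cong e)
    g⊗h-cong (TB.∼-trans e f)   = TC.∼-trans (g⊗h-cong e) (g⊗h-cong f)
    g⊗h-cong (TB.++-cong {x} {x'} {y} {y'} e f) =
      TC.∼-trans (g⊗h-map-++ x y)
        (TC.∼-trans (TC.++-cong (g⊗h-cong e) (g⊗h-cong f)) (TC.∼-sym (g⊗h-map-++ x' y')))
    g⊗h-cong (TB.++-comm x y)   =
      TC.∼-trans (g⊗h-map-++ x y)
        (TC.∼-trans (TC.++-comm (g⊗h x) (g⊗h y)) (TC.∼-sym (g⊗h-map-++ y x)))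
    g⊗h-cong (TB.pure-cong e f) = TC.pure-cong (g-cong e) (h-cong f)
    g⊗h-cong (TB.add-left s s' t)  = TC.∼-trans (TC.pure-cong (g-+ s s') C.refl) (TC.add-left _ _ _)
    g⊗h-cong (TB.add-right s t t') = TC.∼-trans (TC.pure-cong R.refl (h-+ t t')) (TC.add-right _ _ _)
    g⊗h-cong (TB.zero-left t)      = TC.∼-trans (TC.pure-cong g-0 C.refl) (TC.zero-left _)
    g⊗h-cong (TB.balanced a s t)   =
      TC.∼-trans (TC.pure-cong (g-ι a s) C.refl)
        (TC.∼-trans (TC.balanced a (g s) (h t)) (TC.pure-cong R.refl (C.sym (h-ι a t))))

    module _ (g-star : ∀ s → g (R.star s) ≡ R.star (g s)) where

      g⊗h-star : ∀ x → TC.star (g⊗h x) ≡ g⊗h (TB.star x)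
      g⊗h-star []            = ≡.refl
      g⊗h-star ((s , t) ∷ x) = ≡.cong₂ _∷_ (≡.cong (_, h t) (≡.sym (g-star s))) (g⊗h-star x)

      g⊗h-IsSym : ∀ {x} → TB.IsSym x → TC.IsSym (g⊗h x)
      g⊗h-IsSym {x} x-sym = TC.∼-trans (≡⇒∼ (g⊗h-star x)) (g⊗h-cong x-sym)

    g⊗h-· : (∀ s s' → g (s R.* s') R.≈ g s R.* g s') → (∀ t t' → h (t B.* t') C.≈ h t C.* h t') →
            ∀ x y → g⊗h (x TB.· y) TC.∼ g⊗h x TC.· g⊗h y
    g⊗h-· g-* h-* []            y = TC.∼-refl
    g⊗h-· g-* h-* ((s , t) ∷ x) y =
      TC.∼-trans (g⊗h-map-++ (map (λ q → (s R.* proj₁ q , t B.* proj₂ q)) y) (x TB.· y))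
                 (TC.++-cong (row y) (g⊗h-· g-* h-* x y))
      where
      row : ∀ y → g⊗h (map (λ q → (s R.* proj₁ q , t B.* proj₂ q)) y) TC.∼
                  map (λ q → (g s R.* proj₁ q , h t C.* proj₂ q)) (g⊗h y)
      row []              = TC.∼-refl
      row ((s' , t') ∷ y) = TC.++-cong (TC.pure-cong (g-* s s') (h-* t t')) (row y)

module TensorAlgebra {c ℓ r ℓr} {A : CommutativeRing c ℓ} (R : InvolutiveAlgebra A r ℓr)
                     {b ℓb} (B : CommAlg A b ℓb) where
  private
    module R = InvolutiveAlgebra R
    module B = CommAlg B
    module RR = SetoidReasoning R.setoid
  open Tensor R B
  open TensorBasics R B

  _⊗·_ : Pure → Pure → Pure
  (s , t) ⊗· (s' , t') = (s R.* s' , t B.* t')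

  private
    ι-commutes-with-* : ∀ u a v → u B.* (B.ι a B.* v) B.≈ B.ι a B.* (u B.* v)
    ι-commutes-with-* u a v = x∙yz≈y∙xz u (B.ι a) v
      where open CommutativeSemigroupProperties B.*-commutativeSemigroup using (x∙yz≈y∙xz)

    module LeftMultiplication (s : R.Carrier) (t : B.Carrier) =
      TensorMap.Induced R B B (s R.*_) (t B.*_) R.*-congˡ (λ _ _ → R.distribˡ _ _ _) (R.zeroʳ s)
        (λ a s' → RR.begin
           s R.* (R.ι a R.* s')     RR.≈⟨ R.*-assoc _ _ _ ⟨
           (s R.* R.ι a) R.* s'     RR.≈⟨ R.*-congʳ (R.central a s) ⟨
           (R.ι a R.* s) R.* s'     RR.≈⟨ R.*-assoc _ _ _ ⟩
           R.ι a R.* (s R.* s')     RR.∎)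
        B.*-congˡ (λ _ _ → B.distribˡ _ _ _) (ι-commutes-with-* t)

    module Scaling (β : B.Carrier) =
      TensorMap.Induced R B B (λ s → s) (β B.*_) (λ e → e) (λ _ _ → R.refl) R.refl (λ _ _ → R.refl)
        B.*-congˡ (λ _ _ → B.distribˡ _ _ _) (ι-commutes-with-* β)

  ·-++ˡ : ∀ x x' y → (x ++ x') · y ≡ x · y ++ x' · y
  ·-++ˡ []      x' y = ≡.refl
  ·-++ˡ (p ∷ x) x' y =
    ≡.trans (≡.cong (map (p ⊗·_) y ++_) (·-++ˡ x x' y))
            (≡.sym (List.++-assoc (map (p ⊗·_) y) (x · y) (x' · y)))

  ·-++ʳ : ∀ x y y' → x · (y ++ y') ∼ x · y ++ x · y'
  ·-++ʳ []      y y' = ∼-refl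
  ·-++ʳ (p ∷ x) y y' =
    ∼-trans (++-cong (≡⇒∼ (List.map-++ (p ⊗·_) y y')) (·-++ʳ x y y'))
            (++-interchange (map (p ⊗·_) y) (map (p ⊗·_) y') (x · y) (x · y'))

  ·-[]ʳ : ∀ x → x · [] ≡ []
  ·-[]ʳ []      = ≡.refl
  ·-[]ʳ (p ∷ x) = ·-[]ʳ x

  ·-[-]ʳ : ∀ x q → x · [ q ] ≡ map (_⊗· q) x
  ·-[-]ʳ []      q = ≡.refl
  ·-[-]ʳ (p ∷ x) q = ≡.cong (p ⊗· q ∷_) (·-[-]ʳ x q)

  ·-congʳ : ∀ x {y y'} → y ∼ y' → x · y ∼ x · y'
  ·-congʳ []            e = ∼-refl
  ·-congʳ ((s , t) ∷ x) e = ++-cong (LeftMultiplication.g⊗h-cong s t e) (·-congʳ x e)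

  ·-congˡ : ∀ {x x'} y → x ∼ x' → x · y ∼ x' · y
  ·-congˡ y ∼-refl         = ∼-refl
  ·-congˡ y (∼-sym e)      = ∼-sym (·-congˡ y e)
  ·-congˡ y (∼-trans e f)  = ∼-trans (·-congˡ y e) (·-congˡ y f)
  ·-congˡ y (++-cong {x} {x'} {z} {z'} e f) =
    ∼-trans (≡⇒∼ (·-++ˡ x z y))
      (∼-trans (++-cong (·-congˡ y e) (·-congˡ y f)) (≡⇒∼ (≡.sym (·-++ˡ x' z' y))))
  ·-congˡ y (++-comm x z)  =
    ∼-trans (≡⇒∼ (·-++ˡ x z y))
      (∼-trans (++-comm (x · y) (z · y)) (≡⇒∼ (≡.sym (·-++ˡ z x y))))
  ·-congˡ y (pure-cong e f) =
    ++-cong (map-cong _ _ (λ _ → pure-cong (R.*-congʳ e) (B.*-congʳ f)) y) ∼-refl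
  ·-congˡ y (add-left s s' t) =
    ∼-trans (++-cong (map-split _ _ _ (λ _ → ∼-trans (pure-cong (R.distribʳ _ _ _) B.refl)
                                                     (add-left _ _ _)) y) ∼-refl)
            (≡⇒∼ (List.++-assoc (map ((s , t) ⊗·_) y) (map ((s' , t) ⊗·_) y) []))
  ·-congˡ y (add-right s t t') =
    ∼-trans (++-cong (map-split _ _ _ (λ _ → ∼-trans (pure-cong R.refl (B.distribʳ _ _ _))
                                                     (add-right _ _ _)) y) ∼-refl)
            (≡⇒∼ (List.++-assoc (map ((s , t) ⊗·_) y) (map ((s , t') ⊗·_) y) []))
  ·-congˡ y (zero-left t) =
    ++-cong (map-zero _ (λ _ → ∼-trans (pure-cong (R.zeroˡ _) B.refl) (zero-left _)) y) ∼-refl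
  ·-congˡ y (balanced a s t) =
    ++-cong (map-cong _ _ (λ _ → ∼-trans (pure-cong (R.*-assoc _ _ _) B.refl)
                                   (∼-trans (balanced a _ _) (pure-cong R.refl (B.sym (B.*-assoc _ _ _))))) y)
            ∼-refl

  ·-cong : ∀ {x x' y y'} → x ∼ x' → y ∼ y' → x · y ∼ x' · y'
  ·-cong {x' = x'} {y} e f = ∼-trans (·-congˡ y e) (·-congʳ x' f)

  star-· : ∀ x y → star (x · y) ∼ star y · star x
  star-· []            y = ≡⇒∼ (≡.sym (·-[]ʳ (star y)))
  star-· ((s , t) ∷ x) y = begin
    star (map ((s , t) ⊗·_) y ++ x · y)             ≡⟨ List.map-++ _ (map ((s , t) ⊗·_) y) (x · y) ⟩
    star (map ((s , t) ⊗·_) y) ++ star (x · y)      ≈⟨ ++-cong (row y) (star-· x y) ⟩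
    map (_⊗· (R.star s , t)) (star y) ++ star y · star x
                                                    ≡⟨ ≡.cong (_++ star y · star x) (·-[-]ʳ (star y) (R.star s , t)) ⟨
    star y · [ (R.star s , t) ] ++ star y · star x  ≈⟨ ·-++ʳ (star y) [ (R.star s , t) ] (star x) ⟨
    star y · star ((s , t) ∷ x)                     ∎
    where
    open ∼-Reasoning
    row : ∀ y → star (map ((s , t) ⊗·_) y) ∼ map (_⊗· (R.star s , t)) (star y)
    row []              = ∼-refl
    row ((s' , t') ∷ y) = ++-cong (pure-cong (R.star-* s s') (B.*-comm t t')) (row y)

  IsSym-· : ∀ {x y} → IsSym x → IsSym y → x · y ∼ y · x → IsSym (x · y)
  IsSym-· {x} {y} x-sym y-sym xy∼yx = ∼-trans (star-· x y) (∼-trans (·-cong y-sym x-sym) (∼-sym xy∼yx))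

  •-cong : ∀ β {x y} → x ∼ y → β • x ∼ β • y
  •-cong = Scaling.g⊗h-cong

  •-IsSym : ∀ β {x} → IsSym x → IsSym (β • x)
  •-IsSym β = Scaling.g⊗h-IsSym β (λ _ → ≡.refl)

  •-· : ∀ β γ x y → (β • x) · (γ • y) ∼ (β B.* γ) • (x · y)
  •-· β γ []            y = ∼-refl
  •-· β γ ((s , t) ∷ x) y =
    ∼-trans (++-cong (row y) (•-· β γ x y)) (≡⇒∼ (≡.sym (List.map-++ _ (map ((s , t) ⊗·_) y) (x · y))))
    where
    row : ∀ y → map ((s , β B.* t) ⊗·_) (γ • y) ∼ (β B.* γ) • map ((s , t) ⊗·_) y
    row []              = ∼-refl
    row ((s' , t') ∷ y) = ++-cong (pure-cong R.refl (*-interchange β t γ t')) (row y)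
      where open CommutativeSemigroupProperties B.*-commutativeSemigroup renaming (interchange to *-interchange)

  1⊗-IsSym : ∀ β → IsSym [ (R.1# , β) ]
  1⊗-IsSym β = pure-cong (star-1# R) B.refl

  1⊗-central : ∀ β x → [ (R.1# , β) ] · x ∼ x · [ (R.1# , β) ]
  1⊗-central β x =
    ∼-trans (≡⇒∼ (List.++-identityʳ _)) (∼-trans (row x) (≡⇒∼ (≡.sym (·-[-]ʳ x (R.1# , β)))))
    where
    row : ∀ x → map ((R.1# , β) ⊗·_) x ∼ map (_⊗· (R.1# , β)) x
    row []            = ∼-refl
    row ((s , t) ∷ x) =
      ++-cong (pure-cong (R.trans (R.*-identityˡ s) (R.sym (R.*-identityʳ s))) (B.*-comm β t)) (row x)

module BaseChange {c ℓ r ℓr} {A : CommutativeRing c ℓ} (R : InvolutiveAlgebra A r ℓr)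
                  {b ℓb b' ℓb'} {B : CommAlg A b ℓb} {C : CommAlg A b' ℓb'} (f : AlgHom B C) where
  private
    module R = InvolutiveAlgebra R
    module C = CommAlg C
    module f = RingHomomorphism (AlgHom.hom f)
    module Map = TensorMap.Induced R B C (λ s → s) (AlgHom.⟦_⟧ f) (λ e → e) (λ _ _ → R.refl) R.refl
      (λ _ _ → R.refl) f.⟦⟧-cong f.+-homo (λ a t → C.trans (f.*-homo _ _) (C.*-congʳ (AlgHom.over-A f a)))
    module TB = Tensor R B
    module TC = Tensor R C

  baseChange-cong : ∀ {x y} → x TB.∼ y → baseChange R f x TC.∼ baseChange R f y
  baseChange-cong = Map.g⊗h-cong

  baseChange-· : ∀ x y → baseChange R f (x TB.· y) TC.∼ baseChange R f x TC.· baseChange R f y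
  baseChange-· = Map.g⊗h-· (λ _ _ → R.refl) f.*-homo

  baseChange-IsSym : ∀ {x} → TB.IsSym x → TC.IsSym (baseChange R f x)
  baseChange-IsSym = Map.g⊗h-IsSym (λ _ → ≡.refl)

module Segment {c ℓ r ℓr} {A : CommutativeRing c ℓ} (R : InvolutiveAlgebra A r ℓr)
               {b ℓb} (B : CommAlg A b ℓb) where
  private
    module R = InvolutiveAlgebra R
    module B = CommAlg B
    module TB = Tensor R B
    module TX = Tensor R (PolynomialAlgebra.B[X] B)
    module AlgX = TensorAlgebra R (PolynomialAlgebra.B[X] B)
    module BasicsB = TensorBasics R B
    module BasicsX = TensorBasics R (PolynomialAlgebra.B[X] B)
  open PolynomialAlgebra B

  X 1-X : Poly
  X   = B.0# ∷ B.1# ∷ []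
  1-X = B.1# ∷ B.- B.1# ∷ []

  1-X⊗1 : R.Carrier × Poly
  1-X⊗1 = (R.1# , 1-X)

  X•_ : TB.T → TX.T
  X• z = X TX.• baseChange R constAlgHom z

  segment : TB.T → TX.T
  segment z = 1-X⊗1 ∷ X• z

  segment-IsSym : ∀ {z} → TB.IsSym z → TX.IsSym (segment z)
  segment-IsSym z-sym =
    TX.++-cong (AlgX.1⊗-IsSym 1-X) (AlgX.•-IsSym X (BaseChange.baseChange-IsSym R constAlgHom z-sym))

  segment-comm : ∀ {x y} → x TB.· y TB.∼ y TB.· x → segment x TX.· segment y TX.∼ segment y TX.· segment x
  segment-comm {x} {y} xy∼yx = begin
    segment x TX.· segment y
      ≈⟨ expand x y ⟩
    ([ 1-X⊗1 ] TX.· [ 1-X⊗1 ] ++ [ 1-X⊗1 ] TX.· X• y) ++ (X• x TX.· [ 1-X⊗1 ] ++ X• x TX.· X• y)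
      ≈⟨ BasicsX.++-interchange ([ 1-X⊗1 ] TX.· [ 1-X⊗1 ]) ([ 1-X⊗1 ] TX.· X• y) (X• x TX.· [ 1-X⊗1 ]) (X• x TX.· X• y) ⟩
    ([ 1-X⊗1 ] TX.· [ 1-X⊗1 ] ++ X• x TX.· [ 1-X⊗1 ]) ++ ([ 1-X⊗1 ] TX.· X• y ++ X• x TX.· X• y)
      ≈⟨ TX.++-cong (TX.++-cong (TX.∼-refl {[ 1-X⊗1 ] TX.· [ 1-X⊗1 ]}) (TX.∼-sym (AlgX.1⊗-central 1-X (X• x))))
                    (TX.++-cong (AlgX.1⊗-central 1-X (X• y)) X•-comm) ⟩
    ([ 1-X⊗1 ] TX.· [ 1-X⊗1 ] ++ [ 1-X⊗1 ] TX.· X• x) ++ (X• y TX.· [ 1-X⊗1 ] ++ X• y TX.· X• x)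
      ≈⟨ expand y x ⟨
    segment y TX.· segment x ∎
    where
    open BasicsX.∼-Reasoning
    expand : ∀ a b → segment a TX.· segment b TX.∼
             ([ 1-X⊗1 ] TX.· [ 1-X⊗1 ] ++ [ 1-X⊗1 ] TX.· X• b) ++ (X• a TX.· [ 1-X⊗1 ] ++ X• a TX.· X• b)
    expand a b = TX.∼-trans (BasicsX.≡⇒∼ (AlgX.·-++ˡ [ 1-X⊗1 ] (X• a) (segment b)))
      (TX.++-cong (AlgX.·-++ʳ [ 1-X⊗1 ] [ 1-X⊗1 ] (X• b)) (AlgX.·-++ʳ (X• a) [ 1-X⊗1 ] (X• b)))
    X•-comm : X• x TX.· X• y TX.∼ X• y TX.· X• x
    X•-comm = begin
      X• x TX.· X• y                                ≈⟨ AlgX.•-· X X (const⊗ x) (const⊗ y) ⟩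
      (X ⊠ X) TX.• (const⊗ x TX.· const⊗ y)         ≈⟨ AlgX.•-cong (X ⊠ X) (BaseChange.baseChange-· R constAlgHom x y) ⟨
      (X ⊠ X) TX.• const⊗ (x TB.· y)                ≈⟨ AlgX.•-cong (X ⊠ X) (BaseChange.baseChange-cong R constAlgHom xy∼yx) ⟩
      (X ⊠ X) TX.• const⊗ (y TB.· x)                ≈⟨ AlgX.•-cong (X ⊠ X) (BaseChange.baseChange-· R constAlgHom y x) ⟩
      (X ⊠ X) TX.• (const⊗ y TX.· const⊗ x)         ≈⟨ AlgX.•-· X X (const⊗ y) (const⊗ x) ⟨
      X• y TX.· X• x                                ∎
      where
      const⊗ : TB.T → TX.T
      const⊗ = baseChange R constAlgHom

  eval₀-segment : ∀ z → baseChange R eval₀AlgHom (segment z) TB.∼ TB.one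
  eval₀-segment z = TB.++-cong TB.∼-refl (X•-eval₀ z)
    where
    X•-eval₀ : ∀ z → baseChange R eval₀AlgHom (X• z) TB.∼ []
    X•-eval₀ []            = TB.∼-refl
    X•-eval₀ ((s , t) ∷ z) =
      TB.++-cong (BasicsB.pure-zeroʳ s (B.trans (eval₀-⊠ X (const t)) (B.zeroˡ t))) (X•-eval₀ z)

  eval₁-segment : ∀ z → baseChange R eval₁AlgHom (segment z) TB.∼ z
  eval₁-segment z =
    TB.++-cong (BasicsB.pure-zeroʳ R.1# (B.trans (B.+-congˡ (B.+-identityʳ _)) (B.-‿inverseʳ _))) (X•-eval₁ z)
    where
    X•-eval₁ : ∀ z → baseChange R eval₁AlgHom (X• z) TB.∼ z
    X•-eval₁ []            = TB.∼-refl
    X•-eval₁ ((s , t) ∷ z) = TB.++-cong (TB.pure-cong R.refl (B.trans (eval₁-⊠ X (const t)) X₁·t≈t)) (X•-eval₁ z)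
      where
      X₁·t≈t : eval₁ X B.* eval₁ (const t) B.≈ t
      X₁·t≈t = B.trans (B.*-cong (B.trans (B.+-identityˡ _) (B.+-identityʳ _)) (B.+-identityʳ t)) (B.*-identityˡ t)

module WeakSymplecticDetLawProperties {c ℓ r ℓr} {A : CommutativeRing c ℓ} {R : InvolutiveAlgebra A r ℓr}
                                      {d : ℕ} (L : WeakSymplecticDetLaw R d) where
  open WeakSymplecticDetLaw L
  private
    module A = CommutativeRing A
    module T (B : CommAlg A c ℓ) = Tensor R B

  P-natural : ∀ {B C : CommAlg A c ℓ} (f : AlgHom B C) {w z} (w-sym : T.IsSym B w) (z-sym : T.IsSym C z) →
              T._∼_ C (baseChange R f w) z → CommAlg._≈_ C (AlgHom.⟦_⟧ f (P B w w-sym)) (P C z z-sym)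
  P-natural {B} {C} f {w} w-sym z-sym fw∼z =
    C.trans (C.sym (P-nat B C f w w-sym (BaseChange.baseChange-IsSym R f w-sym))) (P-cong C _ z-sym fw∼z)
    where module C = CommAlg C

  P-one-any : ∀ B (one-sym : T.IsSym B (T.one B)) → CommAlg._≈_ B (P B (T.one B) one-sym) (CommAlg.1# B)
  P-one-any B one-sym = begin
    P B (T.one B) one-sym         ≈⟨ P-natural A→B (TensorAlgebra.1⊗-IsSym R (selfAlg A) A.1#) one-sym
                                                   (T.pure-cong R.refl ι.1#-homo) ⟨
    B.ι (P (selfAlg A) (T.one (selfAlg A)) _)
                                  ≈⟨ ι.⟦⟧-cong (P-one _) ⟩
    B.ι A.1#                      ≈⟨ ι.1#-homo ⟩
    B.1#                          ∎
    where
    module R = InvolutiveAlgebra R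
    module B = CommAlg B
    module ι = RingHomomorphism (CommAlg.structure B)
    open SetoidReasoning B.setoid
    A→B : AlgHom (selfAlg A) B
    A→B = record { hom = CommAlg.structure B ; over-A = λ _ → B.refl }

  P-·-square : ∀ B {x y} (x-sym : T.IsSym B x) (y-sym : T.IsSym B y) (xy-sym : T.IsSym B (T._·_ B x y)) →
               let open CommAlg B in
               P B (T._·_ B x y) xy-sym * P B (T._·_ B x y) xy-sym
                 ≈ (P B x x-sym * P B y y-sym) * (P B x x-sym * P B y y-sym)
  P-·-square B {x} {y} x-sym y-sym xy-sym = begin
    P B (x · y) xy-sym * P B (x · y) xy-sym   ≈⟨ P-square B (x · y) xy-sym ⟩
    D B (x · y)                               ≈⟨ D-mul B x y ⟩
    D B x * D B y                             ≈⟨ *-cong (P-square B x x-sym) (P-square B y y-sym) ⟨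
    (Px * Px) * (Py * Py)                     ≈⟨ interchange Px Px Py Py ⟩
    (Px * Py) * (Px * Py)                     ∎
    where
    open CommAlg B
    open Tensor R B using (_·_)
    open SetoidReasoning setoid
    open CommutativeSemigroupProperties *-commutativeSemigroup using (interchange)
    Px = P B x x-sym
    Py = P B y y-sym

  module _ (two : TwoInvertible A) (B : CommAlg A c ℓ) where
    private
      module B = CommAlg B
      module TB = Tensor R B
      module TX = Tensor R (PolynomialAlgebra.B[X] B)
      one-sym : TB.IsSym TB.one
      one-sym = TensorAlgebra.1⊗-IsSym R B B.1#
    open PolynomialAlgebra B
    open Segment R B

    eval₀-P-segment : ∀ {z} (z-sym : TB.IsSym z) → eval₀ (P B[X] (segment z) (segment-IsSym z-sym)) B.≈ B.1#
    eval₀-P-segment {z} z-sym =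
      B.trans (P-natural eval₀AlgHom (segment-IsSym z-sym) one-sym (eval₀-segment z)) (P-one-any B one-sym)

    eval₀-segment-· : ∀ x y → baseChange R eval₀AlgHom (segment x TX.· segment y) TB.∼ TB.one
    eval₀-segment-· x y = TB.∼-trans (BaseChange.baseChange-· R eval₀AlgHom (segment x) (segment y))
      (TB.∼-trans (TensorAlgebra.·-cong R B (eval₀-segment x) (eval₀-segment y))
                  (TB.pure-cong (InvolutiveAlgebra.*-identityˡ R _) (B.*-identityˡ _)))

    P-segment-· : ∀ {x y} (x-sym : TB.IsSym x) (y-sym : TB.IsSym y)
                  (Sxy-sym : TX.IsSym (segment x TX.· segment y)) →
                  P B[X] (segment x TX.· segment y) Sxy-sym
                    ≋ P B[X] (segment x) (segment-IsSym x-sym) ⊠ P B[X] (segment y) (segment-IsSym y-sym)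
    P-segment-· {x} {y} x-sym y-sym Sxy-sym =
      ≋-from-squares-eval₀≈1 two B
        (B.trans (P-natural eval₀AlgHom Sxy-sym one-sym (eval₀-segment-· x y)) (P-one-any B one-sym))
        (B.trans (eval₀-⊠ (P B[X] (segment x) _) (P B[X] (segment y) _))
                 (B.trans (B.*-cong (eval₀-P-segment x-sym) (eval₀-P-segment y-sym)) (B.*-identityˡ B.1#)))
        (P-·-square B[X] (segment-IsSym x-sym) (segment-IsSym y-sym) Sxy-sym)

    P-·-commuting : ∀ {x y} (x-sym : TB.IsSym x) (y-sym : TB.IsSym y) (xy∼yx : x TB.· y TB.∼ y TB.· x)
                    (xy-sym : TB.IsSym (x TB.· y)) → P B (x TB.· y) xy-sym B.≈ P B x x-sym B.* P B y y-sym
    P-·-commuting {x} {y} x-sym y-sym xy∼yx xy-sym = begin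
      P B (x TB.· y) xy-sym            ≈⟨ P-natural eval₁AlgHom Sxy-sym xy-sym eval₁-Sxy ⟨
      eval₁ (P B[X] Sxy Sxy-sym)       ≈⟨ eval₁-cong (P-segment-· x-sym y-sym Sxy-sym) ⟩
      eval₁ (Px ⊠ Py)                  ≈⟨ eval₁-⊠ Px Py ⟩
      eval₁ Px B.* eval₁ Py            ≈⟨ B.*-cong (P-natural eval₁AlgHom Sx-sym x-sym (eval₁-segment x))
                                                   (P-natural eval₁AlgHom Sy-sym y-sym (eval₁-segment y)) ⟩
      P B x x-sym B.* P B y y-sym      ∎
      where
      open SetoidReasoning B.setoid
      Sx-sym : TX.IsSym (segment x)
      Sx-sym = segment-IsSym x-sym
      Sy-sym : TX.IsSym (segment y)
      Sy-sym = segment-IsSym y-sym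
      Sxy : TX.T
      Sxy = segment x TX.· segment y
      Sxy-sym : TX.IsSym Sxy
      Sxy-sym = TensorAlgebra.IsSym-· R B[X] Sx-sym Sy-sym (segment-comm {x} {y} xy∼yx)
      Px Py : Poly
      Px = P B[X] (segment x) Sx-sym
      Py = P B[X] (segment y) Sy-sym
      eval₁-Sxy : baseChange R eval₁AlgHom Sxy TB.∼ x TB.· y
      eval₁-Sxy = TB.∼-trans (BaseChange.baseChange-· R eval₁AlgHom (segment x) (segment y))
                             (TensorAlgebra.·-cong R B (eval₁-segment x) (eval₁-segment y))

lemma3p19 : ∀ {c ℓ r ℓr} (A : CommutativeRing c ℓ) → TwoInvertible A →
    (R : InvolutiveAlgebra A r ℓr) (d : ℕ) (L : WeakSymplecticDetLaw R d) →
    (B : CommAlg A c ℓ) (x y : Tensor.T R B) →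
    (px : Tensor.IsSym R B x) (py : Tensor.IsSym R B y) →
    Tensor._∼_ R B (Tensor._·_ R B x y) (Tensor._·_ R B y x) →
    Σ (Tensor.IsSym R B (Tensor._·_ R B x y)) (λ pxy →
    CommAlg._≈_ B (WeakSymplecticDetLaw.P L B (Tensor._·_ R B x y) pxy)
    (CommAlg._*_ B (WeakSymplecticDetLaw.P L B x px)
    (WeakSymplecticDetLaw.P L B y py)))
lemma3p19 A two R d L B x y px py xy∼yx =
  xy-sym , WeakSymplecticDetLawProperties.P-·-commuting L two B px py xy∼yx xy-sym
  where
  xy-sym : Tensor.IsSym R B (Tensor._·_ R B x y)
  xy-sym = TensorAlgebra.IsSym-· R B px py xy∼yx
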